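{- For all sufficiently large integers $x$, \[ M(x)=G^{ -1}(x)+\sum_{1\le k\le x/2}G^{ -1}(k)\left(\pi\!\left(\left\lfloor\frac{x}{k}\right\rfloor\right)-\pi\!\left(\left\lfloor\frac{x}{k+1}\right\rfloor\right)\right), \] where $M(x)=\sum_{n\le x}\mu(n)$, $\pi$ is the prime counting function, and $G^{ -1}(x):=\sum_{n\le x}g^{ -1}(n)$ with $g^{ -1}$ the Dirichlet inverse of $g(n)=\omega(n)+1$.
   Context: $\mu$ is the Möbius function; $\omega(n)$ counts distinct prime divisors of $n$ ($\omega(1)=0$). The Dirichlet inverse $g^{ -1}$ satisfies $\sum_{d\mid n}g(d)g^{ -1}(n/d)=1$ if $n=1$ and $0$ otherwise. -}

module Defs where

open import Data.Nat as ℕ using (ℕ; zero; suc; _/_)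
open import Data.Nat.Divisibility using (_∣_; _∣?_)
open import Data.Nat.Primality using (prime?)
open import Data.Integer as ℤ using (ℤ; +_)
open import Data.List using (List; []; _∷_; filter; length; map; foldr; upTo)
open import Data.Bool.ListAction using (any)
open import Data.Bool using (Bool; true; false; if_then_else_)
open import Relation.Nullary.Decidable using (does)

range1 : ℕ → List ℕ
range1 n = map suc (upTo n)

Σ1 : ℕ → (ℕ → ℤ) → ℤ
Σ1 n f = foldr ℤ._+_ (+ 0) (map f (range1 n))

divisors : ℕ → List ℕ
divisors n = filter (λ d → d ∣? n) (range1 n)

ω : ℕ → ℕ
ω n = length (filter prime? (divisors n))

-- n is squarefree: there is no d ≥ 2 with d² ∣ n (checked for 2 ≤ d ≤ n+1)
squarefreeᵇ : ℕ → Bool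
squarefreeᵇ n = if any (λ d → does ((suc (suc d) ℕ.* suc (suc d)) ∣? n)) (upTo n)
                then false else true

μ : ℕ → ℤ
μ n = if squarefreeᵇ n then (ℤ.- (+ 1)) ℤ.^ ω n else + 0

M : ℕ → ℤ
M x = Σ1 x μ

π : ℕ → ℕ
π x = length (filter prime? (range1 x))

g : ℕ → ℤ
g n = + (suc (ω n))

_⋆_ : (ℕ → ℤ) → (ℕ → ℤ) → ℕ → ℤ
(f ⋆ h) n = foldr ℤ._+_ (+ 0)
  (map (λ k → if does (suc k ∣? n) then f (suc k) ℤ.* h (n / suc k) else + 0) (upTo n))

ε : ℕ → ℤ
ε 1 = + 1
ε _ = + 0

IsDirichletInverse : (ℕ → ℤ) → (ℕ → ℤ) → Set
IsDirichletInverse f finv = ∀ n → 1 ℕ.≤ n → (f ⋆ finv) n ≡ ε n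
  where open import Relation.Binary.PropositionalEquality using (_≡_)

summatory : (ℕ → ℤ) → ℕ → ℤ
summatory f x = Σ1 x f

term : (ℕ → ℤ) → ℕ → ℕ → ℤ
term ginv x zero = + 0
term ginv x (suc j) = summatory ginv (suc j) ℤ.* (+ π (x / suc j) ℤ.- + π (x / suc (suc j)))

{-# OPTIONS --safe #-}
module Submission where

-- Since ω(n) counts the primes dividing n, g = ω + 1 = (ε + χ) ⋆ 1 with χ the indicator of
-- the primes.  As μ ⋆ 1 = ε, this says μ = g⁻¹ ⋆ (ε + χ), and summing over n ≤ x gives
--   M(x) = Σ_{d ≤ x} g⁻¹(d) (1 + π(⌊x/d⌋)).
-- To avoid associativity of ⋆ this is proved on summatory functions: both sides F satisfy
-- Σ_{d ≤ y} F(⌊y/d⌋) = 1 for every y ≥ 1, and this relation determines F.  Since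
-- π(⌊x/d⌋) = 0 for d > x/2, Abel summation over d ≤ x/2 then turns the right-hand side into
-- the stated formula.

open import Defs
open import Data.Bool using (true; false; if_then_else_; T)
open import Data.Bool.ListAction using (any)
open import Data.Integer as ℤ using (ℤ; +_; _+_; _-_; _*_; -_)
import Data.Integer.Properties as ℤ
open import Algebra.Properties.AbelianGroup ℤ.+-0-abelianGroup using (∙-cancelʳ)
open import Data.Integer.Tactic.RingSolver using (solve-∀)
open import Data.List using (List; []; _∷_; [_]; _∷ʳ_; map; foldr; upTo; filter; length)
import Data.List.Properties as List
open import Data.List.Membership.Propositional using (find; lose)
open import Data.List.Membership.Propositional.Properties using (∈-upTo⁺)
open import Data.List.Relation.Unary.All using (_∷_)
open import Data.List.Relation.Unary.Any.Properties using (any⁺; any⁻)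
open import Data.Nat as ℕ
  using (ℕ; zero; suc; _≤_; _<_; _/_; _∸_; z≤n; s≤s; NonZero; nonTrivial⇒n>1)
import Data.Nat.Properties as ℕ
open import Data.Nat.Coprimality using (Coprime; coprime-divisor)
open import Data.Nat.DivMod
open import Data.Nat.Divisibility
open import Data.Nat.Induction using (<-rec)
open import Data.Nat.ListAction using (product)
open import Data.Nat.Primality
  using (Prime; prime?; prime⇒nonZero; prime⇒nonTrivial; prime⇒irreducible; ¬prime[1]; euclidsLemma)
open import Data.Nat.Primality.Factorisation using (factorise)
open import Data.Product using (∃; _×_; _,_)
open import Data.Sum using (_⊎_; inj₁; inj₂; [_,_]′)
open import Data.Unit using (tt)
open import Function using (_∘_)
open import Level using (0ℓ)
open import Relation.Binary.PropositionalEquality hiding ([_])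
open import Relation.Nullary using (¬_; ¬?; Dec; yes; no; does)
open import Relation.Nullary.Negation using (contradiction)
open import Relation.Unary using (Pred; Decidable)
open ≡-Reasoning

-- Finite sums over 1, …, n

∑ : (ℕ → ℤ) → ℕ → ℤ
∑ f zero = + 0
∑ f (suc n) = ∑ f n + f (suc n)

sumℤ : List ℤ → ℤ
sumℤ = foldr _+_ (+ 0)

sumℤ-∷ʳ : ∀ xs x → sumℤ (xs ∷ʳ x) ≡ sumℤ xs + x
sumℤ-∷ʳ [] x = trans (ℤ.+-identityʳ x) (sym (ℤ.+-identityˡ x))
sumℤ-∷ʳ (y ∷ xs) x = trans (cong (_+_ y) (sumℤ-∷ʳ xs x)) (sym (ℤ.+-assoc y (sumℤ xs) x))

Σ1≡∑ : ∀ f n → Σ1 n f ≡ ∑ f n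
Σ1≡∑ f zero = refl
Σ1≡∑ f (suc n) = begin
  sumℤ (map f (map suc (upTo (suc n))))   ≡⟨ cong (sumℤ ∘ map f ∘ map suc) (sym (List.upTo-∷ʳ n)) ⟩
  sumℤ (map f (map suc (upTo n ∷ʳ n)))    ≡⟨ cong (sumℤ ∘ map f) (List.map-++ suc (upTo n) [ n ]) ⟩
  sumℤ (map f (map suc (upTo n) ∷ʳ suc n)) ≡⟨ cong sumℤ (List.map-++ f (map suc (upTo n)) [ suc n ]) ⟩
  sumℤ (map f (range1 n) ∷ʳ f (suc n))    ≡⟨ sumℤ-∷ʳ (map f (range1 n)) (f (suc n)) ⟩
  Σ1 n f + f (suc n)                      ≡⟨ cong (_+ f (suc n)) (Σ1≡∑ f n) ⟩
  ∑ f n + f (suc n)                       ∎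

∑-cong : ∀ {f h} n → (∀ j → j < n → f (suc j) ≡ h (suc j)) → ∑ f n ≡ ∑ h n
∑-cong zero _ = refl
∑-cong (suc n) eq = cong₂ _+_ (∑-cong n (λ j j<n → eq j (ℕ.m<n⇒m<1+n j<n))) (eq n ℕ.≤-refl)

∑-cong′ : ∀ {f h} n → (∀ k → f k ≡ h k) → ∑ f n ≡ ∑ h n
∑-cong′ n eq = ∑-cong n (λ j _ → eq (suc j))

∑-zero : ∀ {f} n → (∀ j → j < n → f (suc j) ≡ + 0) → ∑ f n ≡ + 0
∑-zero zero _ = refl
∑-zero (suc n) eq =
  trans (cong₂ _+_ (∑-zero n (λ j j<n → eq j (ℕ.m<n⇒m<1+n j<n))) (eq n ℕ.≤-refl)) (ℤ.+-identityʳ (+ 0))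

∑-distrib-+ : ∀ f h n → ∑ (λ k → f k + h k) n ≡ ∑ f n + ∑ h n
∑-distrib-+ f h zero = refl
∑-distrib-+ f h (suc n) = begin
  ∑ (λ k → f k + h k) n + (f (suc n) + h (suc n))
    ≡⟨ cong (_+ (f (suc n) + h (suc n))) (∑-distrib-+ f h n) ⟩
  ∑ f n + ∑ h n + (f (suc n) + h (suc n))
    ≡⟨ interchange (∑ f n) (∑ h n) (f (suc n)) (h (suc n)) ⟩
  ∑ f n + f (suc n) + (∑ h n + h (suc n)) ∎
  where
  interchange : ∀ a b c d → a + b + (c + d) ≡ a + c + (b + d)
  interchange = solve-∀

∑-*ˡ : ∀ c f n → ∑ (λ k → c * f k) n ≡ c * ∑ f n
∑-*ˡ c f zero = sym (ℤ.*-zeroʳ c)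
∑-*ˡ c f (suc n) =
  trans (cong (_+ c * f (suc n)) (∑-*ˡ c f n)) (sym (ℤ.*-distribˡ-+ c (∑ f n) (f (suc n))))

∑-neg : ∀ f n → ∑ (λ k → - f k) n ≡ - ∑ f n
∑-neg f n = begin
  ∑ (λ k → - f k) n        ≡⟨ ∑-cong′ n (λ k → sym (ℤ.-1*i≡-i (f k))) ⟩
  ∑ (λ k → ℤ.-1ℤ * f k) n  ≡⟨ ∑-*ˡ ℤ.-1ℤ f n ⟩
  ℤ.-1ℤ * ∑ f n            ≡⟨ ℤ.-1*i≡-i (∑ f n) ⟩
  - ∑ f n                  ∎

∑-truncate : ∀ {f m} n → m ≤ n → (∀ j → m ≤ j → j < n → f (suc j) ≡ + 0) → ∑ f n ≡ ∑ f m
∑-truncate zero z≤n _ = refl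
∑-truncate {f} {m} (suc n) m≤1+n eq with ℕ.m≤n⇒m<n∨m≡n m≤1+n
... | inj₂ refl = refl
... | inj₁ m<1+n = begin
  ∑ f n + f (suc n) ≡⟨ cong₂ _+_ (∑-truncate n m≤n (λ j m≤j j<n → eq j m≤j (ℕ.m<n⇒m<1+n j<n)))
                                 (eq n m≤n ℕ.≤-refl) ⟩
  ∑ f m + + 0       ≡⟨ ℤ.+-identityʳ (∑ f m) ⟩
  ∑ f m             ∎
  where m≤n = ℕ.m<1+n⇒m≤n m<1+n

∑-comm : ∀ m n (φ : ℕ → ℕ → ℤ) → ∑ (λ a → ∑ (φ a) n) m ≡ ∑ (λ b → ∑ (λ a → φ a b) m) n
∑-comm zero n φ = sym (∑-zero n (λ _ _ → refl))
∑-comm (suc m) n φ = begin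
  ∑ (λ a → ∑ (φ a) n) m + ∑ (φ (suc m)) n
    ≡⟨ cong (_+ ∑ (φ (suc m)) n) (∑-comm m n φ) ⟩
  ∑ (λ b → ∑ (λ a → φ a b) m) n + ∑ (φ (suc m)) n
    ≡⟨ sym (∑-distrib-+ (λ b → ∑ (λ a → φ a b) m) (φ (suc m)) n) ⟩
  ∑ (λ b → ∑ (λ a → φ a b) m + φ (suc m) b) n ∎

∑-shift : ∀ f n → ∑ f (suc n) ≡ f 1 + ∑ (λ k → f (suc k)) n
∑-shift f zero = trans (ℤ.+-identityˡ (f 1)) (sym (ℤ.+-identityʳ (f 1)))
∑-shift f (suc n) = begin
  ∑ f (suc n) + f (2 ℕ.+ n)                    ≡⟨ cong (_+ f (2 ℕ.+ n)) (∑-shift f n) ⟩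
  f 1 + ∑ (λ k → f (suc k)) n + f (2 ℕ.+ n)    ≡⟨ ℤ.+-assoc (f 1) (∑ (λ k → f (suc k)) n) (f (2 ℕ.+ n)) ⟩
  f 1 + (∑ (λ k → f (suc k)) n + f (2 ℕ.+ n))  ∎

∑-ε : ∀ {n} → 1 ≤ n → ∑ ε n ≡ + 1
∑-ε {suc n} _ = trans (∑-shift ε n) (cong (_+_ (+ 1)) (∑-zero n (λ _ _ → refl)))

∑-≗ε : ∀ {f y} → (∀ n → 1 ≤ n → f n ≡ ε n) → 1 ≤ y → ∑ f y ≡ + 1
∑-≗ε {f} {y} f≗ε 1≤y = trans (∑-cong y (λ j _ → f≗ε (suc j) (s≤s z≤n))) (∑-ε 1≤y)

∑-by-parts : ∀ (u a : ℕ → ℤ) K →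
             ∑ (λ k → ∑ u k * (a k - a (suc k))) K ≡ ∑ (λ k → u k * a k) K - ∑ u K * a (suc K)
∑-by-parts u a zero = sym (cong (_-_ (+ 0)) (ℤ.*-zeroˡ (a 1)))
∑-by-parts u a (suc K) = begin
  ∑ (λ k → ∑ u k * (a k - a (suc k))) K + ∑ u (suc K) * (a (suc K) - a (2 ℕ.+ K))
    ≡⟨ cong (_+ ∑ u (suc K) * (a (suc K) - a (2 ℕ.+ K))) (∑-by-parts u a K) ⟩
  ∑ ua K - ∑ u K * a (suc K) + (∑ u K + u (suc K)) * (a (suc K) - a (2 ℕ.+ K))
    ≡⟨ step (∑ ua K) (∑ u K) (u (suc K)) (a (suc K)) (a (2 ℕ.+ K)) ⟩
  ∑ ua K + u (suc K) * a (suc K) - (∑ u K + u (suc K)) * a (2 ℕ.+ K) ∎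
  where
  ua = λ k → u k * a k
  step : ∀ s U v a₁ a₂ → s - U * a₁ + (U + v) * (a₁ - a₂) ≡ s + v * a₁ - (U + v) * a₂
  step = solve-∀

when : ∀ {P : Set} → Dec P → ℤ → ℤ
when P? x = if does P? then x else + 0

when-yes : ∀ {P : Set} (P? : Dec P) {x} → P → when P? x ≡ x
when-yes (yes _) _ = refl
when-yes (no ¬p) p = contradiction p ¬p

when-no : ∀ {P : Set} (P? : Dec P) {x} → ¬ P → when P? x ≡ + 0
when-no (yes p) ¬p = contradiction p ¬p
when-no (no _) _ = refl

when-zero : ∀ {P : Set} (P? : Dec P) → when P? (+ 0) ≡ + 0
when-zero (yes _) = refl
when-zero (no _) = refl

when-+ : ∀ {P : Set} (P? : Dec P) x y → when P? (x + y) ≡ when P? x + when P? y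
when-+ (yes _) x y = refl
when-+ (no _) x y = refl

when+when¬ : ∀ {P : Set} (P? : Dec P) x → when P? x + when (¬? P?) x ≡ x
when+when¬ (yes _) x = ℤ.+-identityʳ x
when+when¬ (no _) x = ℤ.+-identityˡ x

-- Integer division

-- ⌊ x / 0 ⌋ = 0 is a junk value; sums over d only evaluate ⌊ x / d ⌋ at d ≥ 1.
⌊_/_⌋ : ℕ → ℕ → ℕ
⌊ x / zero ⌋ = 0
⌊ x / suc d ⌋ = x / suc d

⌊/⌋-⌊/⌋-comm : ∀ x d k → ⌊ ⌊ x / d ⌋ / k ⌋ ≡ ⌊ ⌊ x / k ⌋ / d ⌋
⌊/⌋-⌊/⌋-comm x zero zero = refl
⌊/⌋-⌊/⌋-comm x zero (suc k) = 0/n≡0 (suc k)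
⌊/⌋-⌊/⌋-comm x (suc d) zero = sym (0/n≡0 (suc d))
⌊/⌋-⌊/⌋-comm x (suc d) (suc k) = begin
  x / suc d / suc k       ≡⟨ m/n/o≡m/[n*o] x (suc d) (suc k) ⟩
  x / (suc d ℕ.* suc k)   ≡⟨ /-congʳ {m = x} (ℕ.*-comm (suc d) (suc k)) ⟩
  x / (suc k ℕ.* suc d)   ≡⟨ sym (m/n/o≡m/[n*o] x (suc k) (suc d)) ⟩
  x / suc k / suc d       ∎

m*n/m≡n : ∀ m n .{{_ : NonZero m}} → m ℕ.* n / m ≡ n
m*n/m≡n m n = trans (/-congˡ (ℕ.*-comm m n)) (m*n/n≡m n m)

/-unique : ∀ {x q} d .{{_ : NonZero d}} → q ℕ.* d ≤ x → x < suc q ℕ.* d → x / d ≡ q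
/-unique {x} {q} d qd≤x x<[1+q]d = begin
  x / d                   ≡⟨ /-congˡ (sym r+qd≡x) ⟩
  (r ℕ.+ q ℕ.* d) / d     ≡⟨ +-distrib-/-∣ʳ r (n∣m*n q) ⟩
  r / d ℕ.+ q ℕ.* d / d   ≡⟨ cong₂ ℕ._+_ (m<n⇒m/n≡0 r<d) (m*n/n≡m q d) ⟩
  q                       ∎
  where
  r = x ∸ q ℕ.* d
  r+qd≡x : r ℕ.+ q ℕ.* d ≡ x
  r+qd≡x = ℕ.m∸n+n≡m qd≤x
  r<d : r < d
  r<d = ℕ.+-cancelʳ-< (q ℕ.* d) r d (subst (_< d ℕ.+ q ℕ.* d) (sym r+qd≡x) x<[1+q]d)

suc-/-∣ : ∀ {x} d .{{_ : NonZero d}} → d ∣ suc x → suc x / d ≡ suc (x / d)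
suc-/-∣ {x} d (divides (suc c) 1+x≡[1+c]d) = begin
  suc x / d         ≡⟨ /-congˡ 1+x≡[1+c]d ⟩
  suc c ℕ.* d / d   ≡⟨ m*n/n≡m (suc c) d ⟩
  suc c             ≡⟨ cong suc (sym (/-unique d cd≤x x<[1+c]d)) ⟩
  suc (x / d)       ∎
  where
  x<[1+c]d : x < suc c ℕ.* d
  x<[1+c]d = subst (x <_) 1+x≡[1+c]d ℕ.≤-refl
  cd≤x : c ℕ.* d ≤ x
  cd≤x = ℕ.m<1+n⇒m≤n (subst (c ℕ.* d <_) (sym 1+x≡[1+c]d) (ℕ.m<n+m (c ℕ.* d) (ℕ.>-nonZero⁻¹ d)))

suc-/-∤ : ∀ {x} d .{{_ : NonZero d}} → ¬ d ∣ suc x → suc x / d ≡ x / d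
suc-/-∤ {x} d d∤1+x = /-unique d (ℕ.m≤n⇒m≤1+n (m/n*n≤m x d)) 1+x<[1+q]d
  where
  q = x / d
  x<[1+q]d : x < suc q ℕ.* d
  x<[1+q]d = subst (_< suc q ℕ.* d) (sym (m≡m%n+[m/n]*n x d)) (ℕ.+-monoˡ-< (q ℕ.* d) (m%n<n x d))
  1+x<[1+q]d : suc x < suc q ℕ.* d
  1+x<[1+q]d with ℕ.m≤n⇒m<n∨m≡n x<[1+q]d
  ... | inj₁ 1+x<[1+q]d = 1+x<[1+q]d
  ... | inj₂ 1+x≡[1+q]d = contradiction (divides (suc q) 1+x≡[1+q]d) d∤1+x

≤/⇒*≤ : ∀ {k x} d .{{_ : NonZero d}} → k ≤ x / d → d ℕ.* k ≤ x
≤/⇒*≤ {k} {x} d k≤x/d =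
  subst (_≤ x) (ℕ.*-comm k d) (ℕ.≤-trans (ℕ.*-monoˡ-≤ d k≤x/d) (m/n*n≤m x d))

*≤⇒≤/ : ∀ {k x} d .{{_ : NonZero d}} → d ℕ.* k ≤ x → k ≤ x / d
*≤⇒≤/ {k} {x} d dk≤x = subst (_≤ x / d) (m*n/m≡n d k) (/-monoˡ-≤ d dk≤x)

x/[1+k]<2 : ∀ x {k} → x / 2 ≤ k → x / suc k < 2
x/[1+k]<2 x {k} x/2≤k = m<n*o⇒m/o<n
  (ℕ.<-≤-trans x<[1+x/2]*2 (subst (suc (x / 2) ℕ.* 2 ≤_) (ℕ.*-comm (suc k) 2) (ℕ.*-monoˡ-≤ 2 (s≤s x/2≤k))))
  where
  x<[1+x/2]*2 : x < suc (x / 2) ℕ.* 2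
  x<[1+x/2]*2 = subst (_< suc (x / 2) ℕ.* 2) (sym (m≡m%n+[m/n]*n x 2)) (ℕ.+-monoˡ-< (x / 2 ℕ.* 2) (m%n<n x 2))

∑-multiples : ∀ d .{{_ : NonZero d}} F x →
              ∑ (λ n → when (d ∣? n) (F n)) x ≡ ∑ (λ k → F (d ℕ.* k)) (x / d)
∑-multiples d F zero = sym (cong (∑ _) (0/n≡0 d))
∑-multiples d F (suc x) with d ∣? suc x
... | yes d∣1+x = begin
  ∑ G x + F (suc x)                ≡⟨ cong₂ _+_ (∑-multiples d F x) (cong F (sym d[1+x/d]≡1+x)) ⟩
  ∑ H (x / d) + H (suc (x / d))    ≡⟨ cong (∑ H) (sym (suc-/-∣ d d∣1+x)) ⟩
  ∑ H (suc x / d)                  ∎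
  where
  G = λ n → when (d ∣? n) (F n)
  H = λ k → F (d ℕ.* k)
  d[1+x/d]≡1+x : d ℕ.* suc (x / d) ≡ suc x
  d[1+x/d]≡1+x = trans (cong (d ℕ.*_) (sym (suc-/-∣ d d∣1+x))) (m*[n/m]≡n d∣1+x)
... | no d∤1+x = begin
  ∑ G x + + 0       ≡⟨ ℤ.+-identityʳ (∑ G x) ⟩
  ∑ G x             ≡⟨ ∑-multiples d F x ⟩
  ∑ H (x / d)       ≡⟨ cong (∑ H) (sym (suc-/-∤ d d∤1+x)) ⟩
  ∑ H (suc x / d)   ∎
  where
  G = λ n → when (d ∣? n) (F n)
  H = λ k → F (d ℕ.* k)

∑-/-as-∑-≤ : ∀ d .{{_ : NonZero d}} ψ x → ∑ ψ (x / d) ≡ ∑ (λ k → when (d ℕ.* k ℕ.≤? x) (ψ k)) x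
∑-/-as-∑-≤ d ψ x = begin
  ∑ ψ (x / d)   ≡⟨ ∑-cong (x / d) (λ j j<x/d → sym (when-yes (d ℕ.* suc j ℕ.≤? x) (≤/⇒*≤ d j<x/d))) ⟩
  ∑ Φ (x / d)   ≡⟨ sym (∑-truncate x (m/n≤m x d) beyond) ⟩
  ∑ Φ x         ∎
  where
  Φ = λ k → when (d ℕ.* k ℕ.≤? x) (ψ k)
  beyond : ∀ j → x / d ≤ j → j < x → Φ (suc j) ≡ + 0
  beyond j x/d≤j _ = when-no (d ℕ.* suc j ℕ.≤? x) (ℕ.<⇒≱ (s≤s x/d≤j) ∘ *≤⇒≤/ d)

∑-hyperbola-comm : ∀ x (φ : ℕ → ℕ → ℤ) →
                   ∑ (λ d → ∑ (φ d) ⌊ x / d ⌋) x ≡ ∑ (λ k → ∑ (λ d → φ d k) ⌊ x / k ⌋) x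
∑-hyperbola-comm x φ = begin
  ∑ (λ d → ∑ (φ d) ⌊ x / d ⌋) x
    ≡⟨ ∑-cong x (λ j _ → ∑-/-as-∑-≤ (suc j) (φ (suc j)) x) ⟩
  ∑ (λ d → ∑ (λ k → when (d ℕ.* k ℕ.≤? x) (φ d k)) x) x
    ≡⟨ ∑-comm x x (λ d k → when (d ℕ.* k ℕ.≤? x) (φ d k)) ⟩
  ∑ (λ k → ∑ (λ d → when (d ℕ.* k ℕ.≤? x) (φ d k)) x) x
    ≡⟨ ∑-cong′ x (λ k → ∑-cong′ x (λ d → cong (λ m → when (m ℕ.≤? x) (φ d k)) (ℕ.*-comm d k))) ⟩
  ∑ (λ k → ∑ (λ d → when (k ℕ.* d ℕ.≤? x) (φ d k)) x) x
    ≡⟨ sym (∑-cong x (λ j _ → ∑-/-as-∑-≤ (suc j) (λ d → φ d (suc j)) x)) ⟩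
  ∑ (λ k → ∑ (λ d → φ d k) ⌊ x / k ⌋) x ∎

-- Dirichlet convolution and its summatory form

𝟙 : ℕ → ℤ
𝟙 _ = + 1

∑-divisors : (ℕ → ℤ) → ℕ → ℤ
∑-divisors f n = ∑ (λ d → when (d ∣? n) (f d)) n

⋆-as-∑ : ∀ f h n → (f ⋆ h) n ≡ ∑ (λ d → when (d ∣? n) (f d * h ⌊ n / d ⌋)) n
⋆-as-∑ f h n = trans (cong sumℤ (List.map-∘ (upTo n))) (Σ1≡∑ _ n)

⋆𝟙≡∑-divisors : ∀ f n → (f ⋆ 𝟙) n ≡ ∑-divisors f n
⋆𝟙≡∑-divisors f n = trans (⋆-as-∑ f 𝟙 n) (∑-cong′ n (λ d → cong (when (d ∣? n)) (ℤ.*-identityʳ (f d))))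

-- (f ⊙ F) x is Σ_{d ≤ x} f(d) F(x/d) for a function F of a real variable x, which here only
-- ever depends on ⌊x⌋.
_⊙_ : (ℕ → ℤ) → (ℕ → ℤ) → ℕ → ℤ
(f ⊙ F) x = ∑ (λ d → f d * F ⌊ x / d ⌋) x

⊙-congʳ : ∀ f {F G} → (∀ y → F y ≡ G y) → ∀ x → (f ⊙ F) x ≡ (f ⊙ G) x
⊙-congʳ f F≗G x = ∑-cong′ x (λ d → cong (f d *_) (F≗G ⌊ x / d ⌋))

⊙𝟙≡∑ : ∀ f x → (f ⊙ 𝟙) x ≡ ∑ f x
⊙𝟙≡∑ f x = ∑-cong′ x (λ d → ℤ.*-identityʳ (f d))

⊙-⊙-comm : ∀ f h F x → (f ⊙ (h ⊙ F)) x ≡ (h ⊙ (f ⊙ F)) x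
⊙-⊙-comm f h F x = begin
  ∑ (λ d → f d * ∑ (λ k → h k * F ⌊ ⌊ x / d ⌋ / k ⌋) ⌊ x / d ⌋) x
    ≡⟨ ∑-cong′ x (λ d → sym (∑-*ˡ (f d) _ ⌊ x / d ⌋)) ⟩
  ∑ (λ d → ∑ (λ k → f d * (h k * F ⌊ ⌊ x / d ⌋ / k ⌋)) ⌊ x / d ⌋) x
    ≡⟨ ∑-hyperbola-comm x (λ d k → f d * (h k * F ⌊ ⌊ x / d ⌋ / k ⌋)) ⟩
  ∑ (λ k → ∑ (λ d → f d * (h k * F ⌊ ⌊ x / d ⌋ / k ⌋)) ⌊ x / k ⌋) x
    ≡⟨ ∑-cong′ x (λ k → ∑-cong′ ⌊ x / k ⌋ (λ d → swap (f d) (h k) (cong F (⌊/⌋-⌊/⌋-comm x d k)))) ⟩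
  ∑ (λ k → ∑ (λ d → h k * (f d * F ⌊ ⌊ x / k ⌋ / d ⌋)) ⌊ x / k ⌋) x
    ≡⟨ ∑-cong′ x (λ k → ∑-*ˡ (h k) _ ⌊ x / k ⌋) ⟩
  ∑ (λ k → h k * ∑ (λ d → f d * F ⌊ ⌊ x / k ⌋ / d ⌋) ⌊ x / k ⌋) x ∎
  where
  swap : ∀ a b {u v} → u ≡ v → a * (b * u) ≡ b * (a * v)
  swap a b {u} refl = trans (sym (ℤ.*-assoc a b u)) (trans (cong (_* u) (ℤ.*-comm a b)) (ℤ.*-assoc b a u))

⊙-∑-comm : ∀ f h x → (f ⊙ ∑ h) x ≡ (h ⊙ ∑ f) x
⊙-∑-comm f h x = begin
  (f ⊙ ∑ h) x         ≡⟨ ⊙-congʳ f (λ y → sym (⊙𝟙≡∑ h y)) x ⟩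
  (f ⊙ (h ⊙ 𝟙)) x     ≡⟨ ⊙-⊙-comm f h 𝟙 x ⟩
  (h ⊙ (f ⊙ 𝟙)) x     ≡⟨ ⊙-congʳ h (⊙𝟙≡∑ f) x ⟩
  (h ⊙ ∑ f) x         ∎

∑-⋆ : ∀ f h x → ∑ (f ⋆ h) x ≡ (f ⊙ ∑ h) x
∑-⋆ f h x = begin
  ∑ (f ⋆ h) x                            ≡⟨ ∑-cong′ x (⋆-as-∑ f h) ⟩
  ∑ (λ n → ∑ (summand n) n) x            ≡⟨ ∑-cong x (λ j j<x → sym (∑-truncate x j<x (non-divisor j))) ⟩
  ∑ (λ n → ∑ (summand n) x) x            ≡⟨ ∑-comm x x summand ⟩
  ∑ (λ d → ∑ (λ n → summand n d) x) x    ≡⟨ ∑-cong x (λ j _ → multiples-of (suc j)) ⟩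
  ∑ (λ d → f d * ∑ h ⌊ x / d ⌋) x        ∎
  where
  summand : ℕ → ℕ → ℤ
  summand n d = when (d ∣? n) (f d * h ⌊ n / d ⌋)
  non-divisor : ∀ j i → suc j ≤ i → i < x → summand (suc j) (suc i) ≡ + 0
  non-divisor j i j<i _ = when-no (suc i ∣? suc j) (>⇒∤ (s≤s j<i))
  multiples-of : ∀ d .{{_ : NonZero d}} → ∑ (λ n → summand n d) x ≡ f d * ∑ h (x / d)
  multiples-of d@(suc _) = begin
    ∑ (λ n → summand n d) x                  ≡⟨ ∑-multiples d (λ n → f d * h (n / d)) x ⟩
    ∑ (λ k → f d * h (d ℕ.* k / d)) (x / d)  ≡⟨ ∑-cong′ (x / d) (λ k → cong (λ m → f d * h m) (m*n/m≡n d k)) ⟩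
    ∑ (λ k → f d * h k) (x / d)              ≡⟨ ∑-*ˡ (f d) h (x / d) ⟩
    f d * ∑ h (x / d)                        ∎

𝟙⊙∑≡∑⋆𝟙 : ∀ f x → (𝟙 ⊙ ∑ f) x ≡ ∑ (f ⋆ 𝟙) x
𝟙⊙∑≡∑⋆𝟙 f x = sym (trans (∑-⋆ f 𝟙 x) (⊙-∑-comm f 𝟙 x))

-- Since f 1 = 1, (f ⊙ F) y = F y + (terms involving F at points < y), so F is recovered recursively.
⊙-cancelˡ : ∀ {f F G} → f 1 ≡ + 1 → F 0 ≡ G 0 →
            (∀ y → 1 ≤ y → (f ⊙ F) y ≡ (f ⊙ G) y) → ∀ y → F y ≡ G y
⊙-cancelˡ {f} {F} {G} f1≡1 F0≡G0 f⊙F≡f⊙G = <-rec (λ y → F y ≡ G y) step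
  where
  rest : (ℕ → ℤ) → ℕ → ℤ
  rest H y = ∑ (λ k → f (suc k) * H ⌊ suc y / suc k ⌋) y
  first+rest : ∀ H y → (f ⊙ H) (suc y) ≡ H (suc y) + rest H y
  first+rest H y = begin
    (f ⊙ H) (suc y)                  ≡⟨ ∑-shift (λ d → f d * H ⌊ suc y / d ⌋) y ⟩
    f 1 * H (suc y / 1) + rest H y   ≡⟨ cong (λ c → c * H (suc y / 1) + rest H y) f1≡1 ⟩
    + 1 * H (suc y / 1) + rest H y   ≡⟨ cong (_+ rest H y) (ℤ.*-identityˡ (H (suc y / 1))) ⟩
    H (suc y / 1) + rest H y         ≡⟨ cong (λ z → H z + rest H y) (n/1≡n (suc y)) ⟩
    H (suc y) + rest H y             ∎
  step : ∀ y → (∀ {z} → z < y → F z ≡ G z) → F y ≡ G y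
  step zero _ = F0≡G0
  step (suc y) ih = ∙-cancelʳ (rest F y) (F (suc y)) (G (suc y)) (begin
    F (suc y) + rest F y   ≡⟨ sym (first+rest F y) ⟩
    (f ⊙ F) (suc y)        ≡⟨ f⊙F≡f⊙G (suc y) (s≤s z≤n) ⟩
    (f ⊙ G) (suc y)        ≡⟨ first+rest G y ⟩
    G (suc y) + rest G y   ≡⟨ cong (_+_ (G (suc y))) (sym rest-eq) ⟩
    G (suc y) + rest F y   ∎)
    where
    rest-eq : rest F y ≡ rest G y
    rest-eq = ∑-cong y (λ j _ → cong (f (2 ℕ.+ j) *_) (ih (m/n<m (suc y) (2 ℕ.+ j) (s≤s (s≤s z≤n)))))

-- Counting primes and prime divisors

sumℤ-filter : ∀ {P : Pred ℕ 0ℓ} (P? : Decidable P) f xs →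
              sumℤ (map f (filter P? xs)) ≡ sumℤ (map (λ x → when (P? x) (f x)) xs)
sumℤ-filter P? f [] = refl
sumℤ-filter P? f (x ∷ xs) with P? x
... | yes _ = cong (_+_ (f x)) (sumℤ-filter P? f xs)
... | no _ = trans (sumℤ-filter P? f xs) (sym (ℤ.+-identityˡ _))

length≡sumℤ-𝟙 : ∀ (xs : List ℕ) → + length xs ≡ sumℤ (map 𝟙 xs)
length≡sumℤ-𝟙 [] = refl
length≡sumℤ-𝟙 (x ∷ xs) = cong (_+_ (+ 1)) (length≡sumℤ-𝟙 xs)

χℙ : ℕ → ℤ
χℙ d = when (prime? d) (+ 1)

π≡∑χℙ : ∀ n → + π n ≡ ∑ χℙ n
π≡∑χℙ n = begin
  + length (filter prime? (range1 n))        ≡⟨ length≡sumℤ-𝟙 (filter prime? (range1 n)) ⟩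
  sumℤ (map 𝟙 (filter prime? (range1 n)))    ≡⟨ sumℤ-filter prime? 𝟙 (range1 n) ⟩
  Σ1 n χℙ                                    ≡⟨ Σ1≡∑ χℙ n ⟩
  ∑ χℙ n                                     ∎

ω≡∑-divisors-χℙ : ∀ n → + ω n ≡ ∑-divisors χℙ n
ω≡∑-divisors-χℙ n = begin
  + length (filter prime? (divisors n))       ≡⟨ length≡sumℤ-𝟙 (filter prime? (divisors n)) ⟩
  sumℤ (map 𝟙 (filter prime? (divisors n)))   ≡⟨ sumℤ-filter prime? 𝟙 (divisors n) ⟩
  sumℤ (map χℙ (divisors n))                  ≡⟨ sumℤ-filter (_∣? n) χℙ (range1 n) ⟩
  Σ1 n (λ d → when (d ∣? n) (χℙ d))           ≡⟨ Σ1≡∑ _ n ⟩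
  ∑-divisors χℙ n                             ∎

prime-divisor : ∀ n → 2 ≤ n → ∃ λ p → Prime p × p ∣ n
prime-divisor n@(suc _) 2≤n with factorise n
... | record { factors = [] ; isFactorisation = n≡1 } = contradiction n≡1 (ℕ.<⇒≢ 2≤n ∘ sym)
... | record { factors = p ∷ ps ; isFactorisation = n≡p*∏ps ; factorsPrime = pp ∷ _ } =
  p , pp , divides (product ps) (trans n≡p*∏ps (ℕ.*-comm p (product ps)))

prime∤⇒coprime : ∀ {p n} → Prime p → ¬ p ∣ n → Coprime n p
prime∤⇒coprime pp p∤n (i∣n , i∣p) with prime⇒irreducible pp i∣p
... | inj₁ i≡1 = i≡1
... | inj₂ refl = contradiction i∣n p∤n

∣p*k⇒∣k : ∀ {p d k} → Prime p → ¬ p ∣ d → d ∣ p ℕ.* k → d ∣ k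
∣p*k⇒∣k pp p∤d = coprime-divisor (prime∤⇒coprime pp p∤d)

prime∣p*k : ∀ {p d k} → Prime p → Prime d → d ∣ p ℕ.* k → d ≡ p ⊎ d ∣ k
prime∣p*k {p} {d} {k} pp pd d∣pk with euclidsLemma p k pd d∣pk
... | inj₂ d∣k = inj₂ d∣k
... | inj₁ d∣p with prime⇒irreducible pp d∣p
...   | inj₁ refl = contradiction pd ¬prime[1]
...   | inj₂ d≡p = inj₁ d≡p

∑-δ : ∀ {p n} → 1 ≤ p → p ≤ n → ∑ (λ d → when (d ℕ.≟ p) (+ 1)) n ≡ + 1
∑-δ {p@(suc p-1)} {n} _ p≤n = begin
  ∑ δ n              ≡⟨ ∑-truncate n p≤n (λ j p≤j _ → when-no (suc j ℕ.≟ p) (ℕ.<⇒≢ (s≤s p≤j) ∘ sym)) ⟩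
  ∑ δ p-1 + δ p      ≡⟨ cong₂ _+_ (∑-zero p-1 below) (when-yes (p ℕ.≟ p) refl) ⟩
  + 0 + + 1          ∎
  where
  δ = λ d → when (d ℕ.≟ p) (+ 1)
  below : ∀ j → j < p-1 → δ (suc j) ≡ + 0
  below j j<p-1 = when-no (suc j ℕ.≟ p) (ℕ.<⇒≢ (s≤s j<p-1))

module _ {p k} (pp : Prime p) (p∤k : ¬ p ∣ k) where

  prime-divisors-of-p*k : ∀ d →
    when (d ∣? p ℕ.* k) (χℙ d) ≡ when (d ∣? k) (χℙ d) + when (d ℕ.≟ p) (+ 1)
  prime-divisors-of-p*k d with prime? d | d ∣? k | d ℕ.≟ p
  ... | no ¬pd | _ | yes refl = contradiction pp ¬pd
  ... | no _ | d∣?k | no d≢p =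
    trans (when-zero (d ∣? p ℕ.* k)) (sym (cong₂ _+_ (when-zero d∣?k) (when-no (d ℕ.≟ p) d≢p)))
  ... | yes _ | yes d∣k | yes refl = contradiction d∣k p∤k
  ... | yes _ | yes d∣k | no d≢p =
    trans (when-yes (d ∣? p ℕ.* k) (∣n⇒∣m*n p d∣k)) (sym (cong (_+_ (+ 1)) (when-no (d ℕ.≟ p) d≢p)))
  ... | yes _ | no _ | yes refl =
    trans (when-yes (p ∣? p ℕ.* k) (m∣m*n k)) (sym (cong (_+_ (+ 0)) (when-yes (p ℕ.≟ p) refl)))
  ... | yes pd | no d∤k | no d≢p =
    trans (when-no (d ∣? p ℕ.* k) ([ d≢p , d∤k ]′ ∘ prime∣p*k pp pd))
          (sym (trans (ℤ.+-identityˡ _) (when-no (d ℕ.≟ p) d≢p)))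

  ω[p*k]≡1+ω[k] : 1 ≤ k → ω (p ℕ.* k) ≡ suc (ω k)
  ω[p*k]≡1+ω[k] 1≤k = ℤ.+-injective (begin
    + ω (p ℕ.* k)                          ≡⟨ ω≡∑-divisors-χℙ (p ℕ.* k) ⟩
    ∑-divisors χℙ (p ℕ.* k)                ≡⟨ ∑-cong′ (p ℕ.* k) prime-divisors-of-p*k ⟩
    ∑ (λ d → χℙ∣k d + δ d) (p ℕ.* k)       ≡⟨ ∑-distrib-+ χℙ∣k δ (p ℕ.* k) ⟩
    ∑ χℙ∣k (p ℕ.* k) + ∑ δ (p ℕ.* k)       ≡⟨ cong₂ _+_ (∑-truncate (p ℕ.* k) k≤pk beyond-k) (∑-δ 1≤p p≤pk) ⟩
    ∑-divisors χℙ k + + 1                  ≡⟨ cong (_+ + 1) (sym (ω≡∑-divisors-χℙ k)) ⟩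
    + ω k + + 1                            ≡⟨ cong +_ (ℕ.+-comm (ω k) 1) ⟩
    + suc (ω k)                            ∎)
    where
    instance
      _ = prime⇒nonZero pp
      _ = ℕ.>-nonZero 1≤k
    χℙ∣k = λ d → when (d ∣? k) (χℙ d)
    δ = λ d → when (d ℕ.≟ p) (+ 1)
    1≤p : 1 ≤ p
    1≤p = ℕ.>-nonZero⁻¹ p
    k≤pk : k ≤ p ℕ.* k
    k≤pk = ℕ.m≤n*m k p
    p≤pk : p ≤ p ℕ.* k
    p≤pk = ℕ.m≤m*n p k
    beyond-k : ∀ j → k ≤ j → j < p ℕ.* k → χℙ∣k (suc j) ≡ + 0
    beyond-k j k≤j _ = when-no (suc j ∣? k) (>⇒∤ (s≤s k≤j))

-- The Möbius function

T-does⇒ : ∀ {P : Set} (P? : Dec P) → T (does P?) → P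
T-does⇒ (yes p) _ = p

⇒T-does : ∀ {P : Set} (P? : Dec P) → P → T (does P?)
⇒T-does (yes _) _ = tt
⇒T-does (no ¬p) p = ¬p p

HasSquareFactor : ℕ → Set
HasSquareFactor n = ∃ λ d → 2 ≤ d × d ℕ.* d ∣ n

HasSquareFactor-*ˡ : ∀ m {n} → HasSquareFactor n → HasSquareFactor (m ℕ.* n)
HasSquareFactor-*ˡ m (d , 2≤d , d²∣n) = d , 2≤d , ∣n⇒∣m*n m d²∣n

squarefreeᵇ≡false⇒ : ∀ n → squarefreeᵇ n ≡ false → HasSquareFactor n
squarefreeᵇ≡false⇒ n _ with any (λ d → does (suc (suc d) ℕ.* suc (suc d) ∣? n)) (upTo n) in found
... | true with d , _ , [2+d]²∣n ← find (any⁻ _ (upTo n) (subst T (sym found) tt)) =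
  suc (suc d) , s≤s (s≤s z≤n) , T-does⇒ (suc (suc d) ℕ.* suc (suc d) ∣? n) [2+d]²∣n

HasSquareFactor⇒squarefreeᵇ≡false : ∀ {n} → 1 ≤ n → HasSquareFactor n → squarefreeᵇ n ≡ false
HasSquareFactor⇒squarefreeᵇ≡false _ (1 , s≤s () , _)
HasSquareFactor⇒squarefreeᵇ≡false {n} 1≤n (suc (suc j) , _ , [2+j]²∣n)
  with any (λ d → does (suc (suc d) ℕ.* suc (suc d) ∣? n)) (upTo n)
     | any⁺ (λ d → does (suc (suc d) ℕ.* suc (suc d) ∣? n))
            (lose (∈-upTo⁺ j<n) (⇒T-does (suc (suc j) ℕ.* suc (suc j) ∣? n) [2+j]²∣n))
  where
  j<n : j < n
  j<n = ℕ.≤-trans (ℕ.n≤1+n (suc j))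
          (ℕ.≤-trans (ℕ.m≤m*n (suc (suc j)) (suc (suc j))) (∣⇒≤ {{ℕ.>-nonZero 1≤n}} [2+j]²∣n))
... | true | _ = refl

HasSquareFactor? : ∀ n → Dec (HasSquareFactor n)
HasSquareFactor? zero = yes (2 , ℕ.≤-refl , 4 ∣0)
HasSquareFactor? n@(suc _) with squarefreeᵇ n in sqf
... | false = yes (squarefreeᵇ≡false⇒ n sqf)
... | true = no λ hsf → contradiction (trans (sym sqf) (HasSquareFactor⇒squarefreeᵇ≡false (s≤s z≤n) hsf)) λ ()

μ-squareful : ∀ {n} → 1 ≤ n → HasSquareFactor n → μ n ≡ + 0
μ-squareful 1≤n hsf rewrite HasSquareFactor⇒squarefreeᵇ≡false 1≤n hsf = refl

μ-squarefree : ∀ {n} → ¬ HasSquareFactor n → μ n ≡ ℤ.-1ℤ ℤ.^ ω n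
μ-squarefree {n} ¬hsf with squarefreeᵇ n in sqf
... | true = refl
... | false = contradiction (squarefreeᵇ≡false⇒ n sqf) ¬hsf

module _ {p k} (pp : Prime p) (1≤k : 1 ≤ k) where

  private
    instance _ = prime⇒nonZero pp
    1≤pk : 1 ≤ p ℕ.* k
    1≤pk = ℕ.*-mono-≤ (ℕ.>-nonZero⁻¹ p) 1≤k

  μ[p*k]≡0 : p ∣ k → μ (p ℕ.* k) ≡ + 0
  μ[p*k]≡0 p∣k = μ-squareful 1≤pk (p , nonTrivial⇒n>1 p {{prime⇒nonTrivial pp}} , *-monoʳ-∣ p p∣k)

  HasSquareFactor[p*k]⇒HasSquareFactor[k] : ¬ p ∣ k → HasSquareFactor (p ℕ.* k) → HasSquareFactor k
  HasSquareFactor[p*k]⇒HasSquareFactor[k] p∤k (d , 2≤d , d²∣pk) with p ∣? d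
  ... | yes p∣d = contradiction (*-cancelˡ-∣ p (∣-trans (*-pres-∣ p∣d p∣d) d²∣pk)) p∤k
  ... | no p∤d = d , 2≤d , ∣p*k⇒∣k pp ([ p∤d , p∤d ]′ ∘ euclidsLemma d d pp) d²∣pk

  μ[p*k]≡-μ[k] : ¬ p ∣ k → μ (p ℕ.* k) ≡ - μ k
  μ[p*k]≡-μ[k] p∤k with HasSquareFactor? k
  ... | yes hsf = trans (μ-squareful 1≤pk (HasSquareFactor-*ˡ p hsf)) (sym (cong -_ (μ-squareful 1≤k hsf)))
  ... | no ¬hsf = begin
    μ (p ℕ.* k)              ≡⟨ μ-squarefree (¬hsf ∘ HasSquareFactor[p*k]⇒HasSquareFactor[k] p∤k) ⟩
    ℤ.-1ℤ ℤ.^ ω (p ℕ.* k)    ≡⟨ cong (ℤ.-1ℤ ℤ.^_) (ω[p*k]≡1+ω[k] pp p∤k 1≤k) ⟩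
    ℤ.-1ℤ * ℤ.-1ℤ ℤ.^ ω k    ≡⟨ ℤ.-1*i≡-i _ ⟩
    - (ℤ.-1ℤ ℤ.^ ω k)        ≡⟨ cong -_ (sym (μ-squarefree ¬hsf)) ⟩
    - μ k                    ∎

-- The divisors of p m split into multiples p k of p, where μ (p k) = - μ k unless p ∣ k,
-- and divisors of m coprime to p; the two parts cancel.
∑-divisors-μ-p*m : ∀ {p m} → Prime p → 1 ≤ m → ∑-divisors μ (p ℕ.* m) ≡ + 0
∑-divisors-μ-p*m {p} {m} pp 1≤m = begin
  ∑ A (p ℕ.* m)
    ≡⟨ ∑-cong′ (p ℕ.* m) (λ d → sym (when+when¬ (p ∣? d) (A d))) ⟩
  ∑ (λ d → when (p ∣? d) (A d) + when (¬? (p ∣? d)) (A d)) (p ℕ.* m)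
    ≡⟨ ∑-distrib-+ (λ d → when (p ∣? d) (A d)) (λ d → when (¬? (p ∣? d)) (A d)) (p ℕ.* m) ⟩
  ∑ (λ d → when (p ∣? d) (A d)) (p ℕ.* m) + ∑ (λ d → when (¬? (p ∣? d)) (A d)) (p ℕ.* m)
    ≡⟨ cong₂ _+_ multiples-of-p coprime-to-p ⟩
  - ∑ C m + ∑ C m
    ≡⟨ ℤ.+-inverseˡ (∑ C m) ⟩
  + 0 ∎
  where
  instance _ = prime⇒nonZero pp
  A = λ d → when (d ∣? p ℕ.* m) (μ d)
  C = λ d → when (¬? (p ∣? d)) (when (d ∣? m) (μ d))

  A[p*k]≡-C[k] : ∀ k → 1 ≤ k → A (p ℕ.* k) ≡ - C k
  A[p*k]≡-C[k] k 1≤k with p ∣? k | k ∣? m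
  ... | yes p∣k | _ =
    trans (cong (when (p ℕ.* k ∣? p ℕ.* m)) (μ[p*k]≡0 pp 1≤k p∣k)) (when-zero (p ℕ.* k ∣? p ℕ.* m))
  ... | no p∤k | yes k∣m = trans (when-yes (p ℕ.* k ∣? p ℕ.* m) (*-monoʳ-∣ p k∣m)) (μ[p*k]≡-μ[k] pp 1≤k p∤k)
  ... | no _ | no k∤m = when-no (p ℕ.* k ∣? p ℕ.* m) (k∤m ∘ *-cancelˡ-∣ p)

  multiples-of-p : ∑ (λ d → when (p ∣? d) (A d)) (p ℕ.* m) ≡ - ∑ C m
  multiples-of-p = begin
    ∑ (λ d → when (p ∣? d) (A d)) (p ℕ.* m)   ≡⟨ ∑-multiples p A (p ℕ.* m) ⟩
    ∑ (λ k → A (p ℕ.* k)) (p ℕ.* m / p)       ≡⟨ cong (∑ (λ k → A (p ℕ.* k))) (m*n/m≡n p m) ⟩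
    ∑ (λ k → A (p ℕ.* k)) m                   ≡⟨ ∑-cong m (λ j _ → A[p*k]≡-C[k] (suc j) (s≤s z≤n)) ⟩
    ∑ (λ k → - C k) m                         ≡⟨ ∑-neg C m ⟩
    - ∑ C m                                   ∎

  coprime-part≗C : ∀ d → when (¬? (p ∣? d)) (A d) ≡ C d
  coprime-part≗C d with p ∣? d
  ... | yes _ = refl
  ... | no p∤d with d ∣? m
  ...   | yes d∣m = when-yes (d ∣? p ℕ.* m) (∣n⇒∣m*n p d∣m)
  ...   | no d∤m = when-no (d ∣? p ℕ.* m) (d∤m ∘ ∣p*k⇒∣k pp p∤d)

  coprime-to-p : ∑ (λ d → when (¬? (p ∣? d)) (A d)) (p ℕ.* m) ≡ ∑ C m
  coprime-to-p = trans (∑-cong′ (p ℕ.* m) coprime-part≗C) (∑-truncate (p ℕ.* m) (ℕ.m≤n*m m p) beyond-m)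
    where
    instance _ = ℕ.>-nonZero 1≤m
    beyond-m : ∀ j → m ≤ j → j < p ℕ.* m → C (suc j) ≡ + 0
    beyond-m j m≤j _ = trans (cong (when (¬? (p ∣? suc j))) (when-no (suc j ∣? m) (>⇒∤ (s≤s m≤j))))
                             (when-zero (¬? (p ∣? suc j)))

μ⋆𝟙≡ε : ∀ n → 1 ≤ n → (μ ⋆ 𝟙) n ≡ ε n
μ⋆𝟙≡ε 1 _ = refl
μ⋆𝟙≡ε n@(suc (suc _)) _ with prime-divisor n (s≤s (s≤s z≤n))
... | p , pp , divides m@(suc _) n≡m*p = begin
  (μ ⋆ 𝟙) n                ≡⟨ ⋆𝟙≡∑-divisors μ n ⟩
  ∑-divisors μ n           ≡⟨ cong (∑-divisors μ) (trans n≡m*p (ℕ.*-comm m p)) ⟩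
  ∑-divisors μ (p ℕ.* m)   ≡⟨ ∑-divisors-μ-p*m pp (s≤s z≤n) ⟩
  + 0                      ∎

-- The identity for M

ε+χℙ : ℕ → ℤ
ε+χℙ d = ε d + χℙ d

ε+χℙ⋆𝟙≡g : ∀ n → 1 ≤ n → (ε+χℙ ⋆ 𝟙) n ≡ g n
ε+χℙ⋆𝟙≡g n 1≤n = begin
  (ε+χℙ ⋆ 𝟙) n                                         ≡⟨ ⋆𝟙≡∑-divisors ε+χℙ n ⟩
  ∑ (λ d → when (d ∣? n) (ε d + χℙ d)) n               ≡⟨ ∑-cong′ n (λ d → when-+ (d ∣? n) (ε d) (χℙ d)) ⟩
  ∑ (λ d → when (d ∣? n) (ε d) + when (d ∣? n) (χℙ d)) n
    ≡⟨ ∑-distrib-+ (λ d → when (d ∣? n) (ε d)) (λ d → when (d ∣? n) (χℙ d)) n ⟩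
  ∑-divisors ε n + ∑-divisors χℙ n                     ≡⟨ cong₂ _+_ ∑-divisors-ε (sym (ω≡∑-divisors-χℙ n)) ⟩
  + 1 + + ω n                                          ∎
  where
  ε-divisor : ∀ d → when (d ∣? n) (ε d) ≡ ε d
  ε-divisor 0 = when-zero (0 ∣? n)
  ε-divisor 1 = when-yes (1 ∣? n) (1∣ n)
  ε-divisor d@(suc (suc _)) = when-zero (d ∣? n)
  ∑-divisors-ε : ∑-divisors ε n ≡ + 1
  ∑-divisors-ε = trans (∑-cong′ n ε-divisor) (∑-ε 1≤n)

∑ε+χℙ≡1+π : ∀ {y} → 1 ≤ y → ∑ ε+χℙ y ≡ + 1 + + π y
∑ε+χℙ≡1+π {y} 1≤y = trans (∑-distrib-+ ε χℙ y) (cong₂ _+_ (∑-ε 1≤y) (sym (π≡∑χℙ y)))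

module _ (ginv : ℕ → ℤ) (inverse : IsDirichletInverse g ginv) where

  𝟙⊙[ginv⊙∑ε+χℙ]≡1 : ∀ y → 1 ≤ y → (𝟙 ⊙ (ginv ⊙ ∑ ε+χℙ)) y ≡ + 1
  𝟙⊙[ginv⊙∑ε+χℙ]≡1 y 1≤y = begin
    (𝟙 ⊙ (ginv ⊙ ∑ ε+χℙ)) y     ≡⟨ ⊙-⊙-comm 𝟙 ginv (∑ ε+χℙ) y ⟩
    (ginv ⊙ (𝟙 ⊙ ∑ ε+χℙ)) y     ≡⟨ ⊙-congʳ ginv (𝟙⊙∑≡∑⋆𝟙 ε+χℙ) y ⟩
    (ginv ⊙ ∑ (ε+χℙ ⋆ 𝟙)) y     ≡⟨ ⊙-congʳ ginv (λ z → ∑-cong z (λ j _ → ε+χℙ⋆𝟙≡g (suc j) (s≤s z≤n))) y ⟩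
    (ginv ⊙ ∑ g) y              ≡⟨ ⊙-∑-comm ginv g y ⟩
    (g ⊙ ∑ ginv) y              ≡⟨ sym (∑-⋆ g ginv y) ⟩
    ∑ (g ⋆ ginv) y              ≡⟨ ∑-≗ε inverse 1≤y ⟩
    + 1                         ∎

  ∑μ≡ginv⊙∑ε+χℙ : ∀ x → ∑ μ x ≡ (ginv ⊙ ∑ ε+χℙ) x
  ∑μ≡ginv⊙∑ε+χℙ = ⊙-cancelˡ {𝟙} refl refl λ y 1≤y → begin
    (𝟙 ⊙ ∑ μ) y                 ≡⟨ 𝟙⊙∑≡∑⋆𝟙 μ y ⟩
    ∑ (μ ⋆ 𝟙) y                 ≡⟨ ∑-≗ε μ⋆𝟙≡ε 1≤y ⟩
    + 1                         ≡⟨ sym (𝟙⊙[ginv⊙∑ε+χℙ]≡1 y 1≤y) ⟩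
    (𝟙 ⊙ (ginv ⊙ ∑ ε+χℙ)) y     ∎

π<2≡0 : ∀ {y} → y < 2 → π y ≡ 0
π<2≡0 {0} _ = refl
π<2≡0 {1} _ = refl
π<2≡0 {suc (suc _)} (s≤s (s≤s ()))

⊙∑ε+χℙ-expansion : ∀ h x → (h ⊙ ∑ ε+χℙ) x ≡ ∑ h x + ∑ (term h x) (x / 2)
⊙∑ε+χℙ-expansion h x = begin
  ∑ (λ d → h d * ∑ ε+χℙ ⌊ x / d ⌋) x    ≡⟨ ∑-cong x one-plus-π ⟩
  ∑ (λ d → h d + h d * a d) x           ≡⟨ ∑-distrib-+ h (λ d → h d * a d) x ⟩
  ∑ h x + ∑ (λ d → h d * a d) x         ≡⟨ cong (_+_ (∑ h x)) (∑-truncate x (m/n≤m x 2) vanishes) ⟩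
  ∑ h x + ∑ (λ d → h d * a d) K         ≡⟨ cong (_+_ (∑ h x)) (sym abel) ⟩
  ∑ h x + ∑ (term h x) K                ∎
  where
  K = x / 2
  a : ℕ → ℤ
  a d = + π ⌊ x / d ⌋
  one-plus-π : ∀ j → j < x → h (suc j) * ∑ ε+χℙ (x / suc j) ≡ h (suc j) + h (suc j) * a (suc j)
  one-plus-π j j<x = begin
    h (suc j) * ∑ ε+χℙ (x / suc j)           ≡⟨ cong (h (suc j) *_) (∑ε+χℙ≡1+π (m≥n⇒m/n>0 j<x)) ⟩
    h (suc j) * (+ 1 + a (suc j))            ≡⟨ ℤ.*-distribˡ-+ (h (suc j)) (+ 1) (a (suc j)) ⟩
    h (suc j) * + 1 + h (suc j) * a (suc j)  ≡⟨ cong (_+ h (suc j) * a (suc j)) (ℤ.*-identityʳ (h (suc j))) ⟩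
    h (suc j) + h (suc j) * a (suc j)        ∎
  vanishes : ∀ j → K ≤ j → j < x → h (suc j) * a (suc j) ≡ + 0
  vanishes j K≤j _ = trans (cong (λ n → h (suc j) * + n) (π<2≡0 (x/[1+k]<2 x K≤j))) (ℤ.*-zeroʳ (h (suc j)))
  abel : ∑ (term h x) K ≡ ∑ (λ d → h d * a d) K
  abel = begin
    ∑ (term h x) K
      ≡⟨ ∑-cong K (λ j _ → cong (_* (a (suc j) - a (2 ℕ.+ j))) (Σ1≡∑ h (suc j))) ⟩
    ∑ (λ k → ∑ h k * (a k - a (suc k))) K
      ≡⟨ ∑-by-parts h a K ⟩
    ∑ (λ d → h d * a d) K - ∑ h K * a (suc K)
      ≡⟨ cong (λ n → ∑ (λ d → h d * a d) K - ∑ h K * + n) (π<2≡0 (x/[1+k]<2 x ℕ.≤-refl)) ⟩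
    ∑ (λ d → h d * a d) K - ∑ h K * + 0
      ≡⟨ cong (λ z → ∑ (λ d → h d * a d) K - z) (ℤ.*-zeroʳ (∑ h K)) ⟩
    ∑ (λ d → h d * a d) K - + 0
      ≡⟨ ℤ.+-identityʳ _ ⟩
    ∑ (λ d → h d * a d) K ∎

proposition5p1 : (ginv : ℕ → ℤ) → IsDirichletInverse g ginv →
    ∃ λ x₀ → ∀ x → x₀ ≤ x →
    M x ≡ summatory ginv x
    + Σ1 (x / 2) (term ginv x)
proposition5p1 ginv inverse = 0 , λ x _ → begin
  M x                                           ≡⟨ Σ1≡∑ μ x ⟩
  ∑ μ x                                         ≡⟨ ∑μ≡ginv⊙∑ε+χℙ ginv inverse x ⟩
  (ginv ⊙ ∑ ε+χℙ) x                             ≡⟨ ⊙∑ε+χℙ-expansion ginv x ⟩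
  ∑ ginv x + ∑ (term ginv x) (x / 2)            ≡⟨ sym (cong₂ _+_ (Σ1≡∑ ginv x) (Σ1≡∑ (term ginv x) (x / 2))) ⟩
  summatory ginv x + Σ1 (x / 2) (term ginv x)   ∎
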